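{- Let $G$ with vertex set $V$ be a $2$-nearly Platonic graph of type $(5|3)$ with non-touching exceptional faces of sizes $m$ and $n$. Then $|V|=2(m+n)$.
   Context: All graphs are finite, simple, connected, planar and undirected, considered with a fixed plane embedding. The size of a face is the length of the closed walk bounding it. For integers $k,d$, a $2$-nearly Platonic graph of type $(k|d)$ is a $k$-regular planar graph with $f>4$ faces such that $f-2$ of its faces have size $d$ and the remaining two faces (the exceptional faces) have sizes different from $d$. The exceptional faces are non-touching if their boundaries share no vertex. -}

module Defs where

open import Data.Nat using (ℕ; zero; suc; _+_; _*_; _<_)
open import Data.Fin using (Fin; _≟_)
open import Data.List using (List; length; filter)
open import Data.List.Base using (allFin)
open import Data.Product using (Σ; ∃; _×_; _,_)
open import Relation.Binary.PropositionalEquality using (_≡_; _≢_)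
open import Relation.Nullary using (¬_)
open import Function.Definitions using (Injective; Surjective)

iter : {A : Set} → (A → A) → ℕ → A → A
iter f zero    x = x
iter f (suc k) x = f (iter f k x)

SameOrbit : {A : Set} → (A → A) → A → A → Set
SameOrbit f x y = ∃ λ k → iter f k x ≡ y

-- A graph embedded in an orientable surface, given as a combinatorial map
-- (rotation system) on a finite set of darts (half-edges), together with an
-- explicit labelling of its vertices (orbits of σ) and faces (orbits of φ = σ ∘ α).
record EmbeddedGraph : Set where
  field
    nD nV nF : ℕ
    σ : Fin nD → Fin nD
    σ-inj : Injective _≡_ _≡_ σ
    α : Fin nD → Fin nD
    α-invol : ∀ d → α (α d) ≡ d
    α-free  : ∀ d → α d ≢ d
    vert : Fin nD → Fin nV
    vert-surj : Surjective _≡_ _≡_ vert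
    vert-orb  : ∀ d d' → (vert d ≡ vert d' → SameOrbit σ d d')
                       × (SameOrbit σ d d' → vert d ≡ vert d')
    face : Fin nD → Fin nF
    face-surj : Surjective _≡_ _≡_ face
    face-orb  : ∀ d d' → (face d ≡ face d' → SameOrbit (λ x → σ (α x)) d d')
                       × (SameOrbit (λ x → σ (α x)) d d' → face d ≡ face d')

module _ (G : EmbeddedGraph) where
  open EmbeddedGraph G

  degree : Fin nV → ℕ
  degree v = length (filter (λ d → vert d ≟ v) (allFin nD))

  -- size of a face = length of its closed boundary walk = number of darts in it
  faceSize : Fin nF → ℕ
  faceSize f = length (filter (λ d → face d ≟ f) (allFin nD))

  OnFace : Fin nV → Fin nF → Set
  OnFace v f = ∃ λ d → face d ≡ f × vert d ≡ v

  Simple : Set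
  Simple = (∀ d → vert (α d) ≢ vert d)
         × (∀ d d' → vert d ≡ vert d' → vert (α d) ≡ vert (α d') → d ≡ d')

  data Reach : Fin nD → Fin nD → Set where
    here  : ∀ {d} → Reach d d
    viaσ  : ∀ {d e} → Reach (σ d) e → Reach d e
    viaα  : ∀ {d e} → Reach (α d) e → Reach d e

  Connected : Set
  Connected = ∀ d e → Reach d e

  -- planar (genus 0) embedding: Euler's formula V − E + F = 2, with E = nD/2,
  -- written as 2V + 2F = nD + 4
  Planar : Set
  Planar = 2 * nV + 2 * nF ≡ nD + 4

  Regular : ℕ → Set
  Regular k = ∀ v → degree v ≡ k

  TwoNearlyPlatonic : ℕ → ℕ → Fin nF → Fin nF → Set
  TwoNearlyPlatonic k s f₁ f₂ =
      Simple × Connected × Planar × Regular k × 4 < nF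
    × f₁ ≢ f₂ × faceSize f₁ ≢ s × faceSize f₂ ≢ s
    × (∀ f → f ≢ f₁ → f ≢ f₂ → faceSize f ≡ s)

  NonTouching : Fin nF → Fin nF → Set
  NonTouching f₁ f₂ = ∀ v → OnFace v f₁ → ¬ OnFace v f₂

-- Counting darts twice gives 5V = 2E from 5-regularity and 2E = 3(F − 2) + m + n
-- from the face sizes; together with Euler's formula V − E + F = 2 this leaves
-- exactly V = 2(m + n). More generally, for type (k|s) the same count gives
-- (2s + 2k − sk) V = 2(m + n), and (k|s) = (5|3) is where 2s + 2k − sk = 1.
-- The argument never uses that the exceptional faces are non-touching.
module Submission where

open import Data.Nat using (ℕ; _+_; _*_)
open import Data.Nat.Properties using (+-0-commutativeMonoid; +-cancelˡ-≡; +-identityʳ; *-zeroʳ)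
open import Data.Nat.Tactic.RingSolver using (solve-∀)
open import Data.Fin using (Fin; zero; suc; _≟_)
open import Data.Fin.Properties using (suc-injective)
open import Data.List using (List; []; _∷_; _++_; [_]; length; filter; allFin)
open import Data.List.Properties using (length-++; filter-++; filter-accept; filter-reject; length-tabulate)
open import Data.Vec.Functional using (Vector)
open import Data.Product using (_,_)
open import Data.Empty using (⊥-elim)
open import Function using (id; _∘_)
open import Relation.Binary.PropositionalEquality using (_≡_; _≢_; refl; sym; trans; cong; cong₂; module ≡-Reasoning)
open import Algebra.Properties.CommutativeMonoid.Sum +-0-commutativeMonoid
  using (sum; sum-cong-≗; sum-replicate-zero; ∑-distrib-+)
open import Defs

open ≡-Reasoning

sum-const : ∀ K c → sum {K} (λ _ → c) ≡ K * c
sum-const ℕ.zero    c = refl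
sum-const (ℕ.suc K) c = cong (c +_) (sum-const K c)

sum-except : ∀ {K} (t : Vector ℕ K) {a c} →
             (∀ i → i ≢ a → t i ≡ c) → sum t + c ≡ t a + K * c
sum-except {ℕ.suc K} t {zero} {c} others = begin
  t zero + sum (t ∘ suc) + c      ≡⟨ cong (λ r → t zero + r + c) (sum-cong-≗ tail≗c) ⟩
  t zero + sum {K} (λ _ → c) + c  ≡⟨ cong (λ r → t zero + r + c) (sum-const K c) ⟩
  t zero + K * c + c              ≡⟨ regroup (t zero) (K * c) c ⟩
  t zero + (c + K * c)            ∎
  where
  tail≗c : ∀ i → t (suc i) ≡ c
  tail≗c i = others (suc i) λ ()
  regroup : ∀ x y c → x + y + c ≡ x + (c + y)
  regroup = solve-∀
sum-except {ℕ.suc K} t {suc a} {c} others = begin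
  t zero + sum (t ∘ suc) + c    ≡⟨ regroup (t zero) (sum (t ∘ suc)) c ⟩
  t zero + (sum (t ∘ suc) + c)  ≡⟨ cong₂ _+_ (others zero λ ()) (sum-except (t ∘ suc) tail-others) ⟩
  c + (t (suc a) + K * c)       ≡⟨ swap c (t (suc a)) (K * c) ⟩
  t (suc a) + (c + K * c)       ∎
  where
  tail-others : ∀ i → i ≢ a → t (suc i) ≡ c
  tail-others i i≢a = others (suc i) (i≢a ∘ suc-injective)
  regroup : ∀ x y c → x + y + c ≡ x + (y + c)
  regroup = solve-∀
  swap : ∀ x y z → x + (y + z) ≡ y + (x + z)
  swap = solve-∀

sum-except₂ : ∀ {K} (t : Vector ℕ K) {a b c} → a ≢ b →
              (∀ i → i ≢ a → i ≢ b → t i ≡ c) → sum t + 2 * c ≡ t a + t b + K * c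
sum-except₂ t {zero} {zero} a≢b others = ⊥-elim (a≢b refl)
sum-except₂ {ℕ.suc K} t {zero} {suc b} {c} a≢b others = begin
  t zero + sum (t ∘ suc) + 2 * c    ≡⟨ regroup (t zero) (sum (t ∘ suc)) c ⟩
  t zero + (sum (t ∘ suc) + c) + c  ≡⟨ cong (λ r → t zero + r + c) (sum-except (t ∘ suc) tail-others) ⟩
  t zero + (t (suc b) + K * c) + c  ≡⟨ finish (t zero) (t (suc b)) (K * c) c ⟩
  t zero + t (suc b) + (c + K * c)  ∎
  where
  tail-others : ∀ i → i ≢ b → t (suc i) ≡ c
  tail-others i i≢b = others (suc i) (λ ()) (i≢b ∘ suc-injective)
  regroup : ∀ x y c → x + y + 2 * c ≡ x + (y + c) + c
  regroup = solve-∀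
  finish : ∀ x y z c → x + (y + z) + c ≡ x + y + (c + z)
  finish = solve-∀
sum-except₂ {ℕ.suc K} t {suc a} {zero} {c} a≢b others = begin
  t zero + sum (t ∘ suc) + 2 * c    ≡⟨ regroup (t zero) (sum (t ∘ suc)) c ⟩
  t zero + (sum (t ∘ suc) + c) + c  ≡⟨ cong (λ r → t zero + r + c) (sum-except (t ∘ suc) tail-others) ⟩
  t zero + (t (suc a) + K * c) + c  ≡⟨ finish (t zero) (t (suc a)) (K * c) c ⟩
  t (suc a) + t zero + (c + K * c)  ∎
  where
  tail-others : ∀ i → i ≢ a → t (suc i) ≡ c
  tail-others i i≢a = others (suc i) (i≢a ∘ suc-injective) (λ ())
  regroup : ∀ x y c → x + y + 2 * c ≡ x + (y + c) + c
  regroup = solve-∀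
  finish : ∀ x y z c → x + (y + z) + c ≡ y + x + (c + z)
  finish = solve-∀
sum-except₂ {ℕ.suc K} t {suc a} {suc b} {c} a≢b others = begin
  t zero + sum (t ∘ suc) + 2 * c       ≡⟨ regroup (t zero) (sum (t ∘ suc)) (2 * c) ⟩
  t zero + (sum (t ∘ suc) + 2 * c)     ≡⟨ cong₂ _+_ (others zero (λ ()) (λ ())) (sum-except₂ (t ∘ suc) (a≢b ∘ cong suc) tail-others) ⟩
  c + (t (suc a) + t (suc b) + K * c)  ≡⟨ finish c (t (suc a) + t (suc b)) (K * c) ⟩
  t (suc a) + t (suc b) + (c + K * c)  ∎
  where
  tail-others : ∀ i → i ≢ a → i ≢ b → t (suc i) ≡ c
  tail-others i i≢a i≢b = others (suc i) (i≢a ∘ suc-injective) (i≢b ∘ suc-injective)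
  regroup : ∀ x y z → x + y + z ≡ x + (y + z)
  regroup = solve-∀
  finish : ∀ x y z → x + (y + z) ≡ y + (x + z)
  finish = solve-∀

module _ {A : Set} {K : ℕ} (g : A → Fin K) where

  fibreSize : List A → Fin K → ℕ
  fibreSize xs v = length (filter (λ x → g x ≟ v) xs)

  fibreSize-++ : ∀ xs ys v → fibreSize (xs ++ ys) v ≡ fibreSize xs v + fibreSize ys v
  fibreSize-++ xs ys v =
    trans (cong length (filter-++ (λ x → g x ≟ v) xs ys)) (length-++ (filter (λ x → g x ≟ v) xs))

  sum-fibreSize-[_] : ∀ x → sum (fibreSize [ x ]) ≡ 1
  sum-fibreSize-[ x ] = begin
    sum (fibreSize [ x ])          ≡⟨ +-identityʳ _ ⟨
    sum (fibreSize [ x ]) + 0      ≡⟨ sum-except (fibreSize [ x ]) elsewhere ⟩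
    fibreSize [ x ] (g x) + K * 0  ≡⟨ cong₂ _+_ (cong length (filter-accept (λ y → g y ≟ g x) refl)) (*-zeroʳ K) ⟩
    1 + 0                          ∎
    where
    elsewhere : ∀ v → v ≢ g x → fibreSize [ x ] v ≡ 0
    elsewhere v v≢gx = cong length (filter-reject (λ y → g y ≟ v) (v≢gx ∘ sym))

  sum-fibreSize : ∀ xs → sum (fibreSize xs) ≡ length xs
  sum-fibreSize []       = sum-replicate-zero K
  sum-fibreSize (x ∷ xs) = begin
    sum (fibreSize (x ∷ xs))                        ≡⟨ sum-cong-≗ (fibreSize-++ [ x ] xs) ⟩
    sum (λ v → fibreSize [ x ] v + fibreSize xs v)  ≡⟨ ∑-distrib-+ (fibreSize [ x ]) (fibreSize xs) ⟩
    sum (fibreSize [ x ]) + sum (fibreSize xs)      ≡⟨ cong₂ _+_ sum-fibreSize-[ x ] (sum-fibreSize xs) ⟩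
    1 + length xs                                   ∎

module _ (G : EmbeddedGraph) where
  open EmbeddedGraph G

  sum-degree : sum (degree G) ≡ nD
  sum-degree = trans (sum-fibreSize vert (allFin nD)) (length-tabulate id)

  sum-faceSize : sum (faceSize G) ≡ nD
  sum-faceSize = trans (sum-fibreSize face (allFin nD)) (length-tabulate id)

  regular⇒darts : ∀ {k} → Regular G k → nV * k ≡ nD
  regular⇒darts {k} reg = begin
    nV * k              ≡⟨ sum-const nV k ⟨
    sum {nV} (λ _ → k)  ≡⟨ sum-cong-≗ reg ⟨
    sum (degree G)      ≡⟨ sum-degree ⟩
    nD                  ∎

  twoExceptionalFaces⇒darts : ∀ {s f₁ f₂} → f₁ ≢ f₂ →
    (∀ f → f ≢ f₁ → f ≢ f₂ → faceSize G f ≡ s) →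
    nD + 2 * s ≡ faceSize G f₁ + faceSize G f₂ + nF * s
  twoExceptionalFaces⇒darts {s} {f₁} {f₂} f₁≢f₂ others = begin
    nD + 2 * s                              ≡⟨ cong (_+ 2 * s) sum-faceSize ⟨
    sum (faceSize G) + 2 * s                ≡⟨ sum-except₂ (faceSize G) f₁≢f₂ others ⟩
    faceSize G f₁ + faceSize G f₂ + nF * s  ∎

  twoNearlyPlatonic-vertices : ∀ {k s f₁ f₂} → TwoNearlyPlatonic G k s f₁ f₂ →
    (2 * s + 2 * k) * nV ≡ s * k * nV + 2 * (faceSize G f₁ + faceSize G f₂)
  -- s times Euler's formula plus twice the face count; F then cancels.
  twoNearlyPlatonic-vertices {k} {s} {f₁} {f₂}
                             (_ , _ , euler , reg , _ , f₁≢f₂ , _ , _ , others) =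
    +-cancelˡ-≡ (s * (2 * nF + 4)) _ _ (begin
      s * (2 * nF + 4) + (2 * s + 2 * k) * nV        ≡⟨ expand s k nV nF ⟩
      s * (2 * nV + 2 * nF) + 2 * (nV * k + 2 * s)   ≡⟨ cong₂ (λ e d → s * e + 2 * (d + 2 * s)) euler (regular⇒darts reg) ⟩
      s * (nD + 4) + 2 * (nD + 2 * s)                ≡⟨ cong (λ r → s * (nD + 4) + 2 * r) (twoExceptionalFaces⇒darts f₁≢f₂ others) ⟩
      s * (nD + 4) + 2 * (m + n + nF * s)            ≡⟨ cong (λ d → s * (d + 4) + 2 * (m + n + nF * s)) (regular⇒darts reg) ⟨
      s * (nV * k + 4) + 2 * (m + n + nF * s)        ≡⟨ collect s k nV nF m n ⟩
      s * (2 * nF + 4) + (s * k * nV + 2 * (m + n))  ∎)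
    where
    m n : ℕ
    m = faceSize G f₁
    n = faceSize G f₂
    expand : ∀ s k V F → s * (2 * F + 4) + (2 * s + 2 * k) * V ≡ s * (2 * V + 2 * F) + 2 * (V * k + 2 * s)
    expand = solve-∀
    collect : ∀ s k V F m n → s * (V * k + 4) + 2 * (m + n + F * s) ≡ s * (2 * F + 4) + (s * k * V + 2 * (m + n))
    collect = solve-∀

mainTheorem6 : (G : EmbeddedGraph) (f₁ f₂ : Fin (EmbeddedGraph.nF G)) (m n : ℕ)
    → TwoNearlyPlatonic G 5 3 f₁ f₂
    → NonTouching G f₁ f₂
    → faceSize G f₁ ≡ m → faceSize G f₂ ≡ n
    → EmbeddedGraph.nV G ≡ 2 * (m + n)
mainTheorem6 G f₁ f₂ m n platonic _ refl refl =
  +-cancelˡ-≡ (15 * nV) _ _ (begin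
    15 * nV + nV           ≡⟨ sixteen nV ⟩
    16 * nV                ≡⟨ twoNearlyPlatonic-vertices G platonic ⟩
    15 * nV + 2 * (m + n)  ∎)
  where
  open EmbeddedGraph G
  sixteen : ∀ V → 15 * V + V ≡ 16 * V
  sixteen = solve-∀
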